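{- For all $\phi,\chi\in\mathcal{L}_\blacktriangle$: if $\phi\vdash\chi$ is proved in the calculus $\mathbb{S}(\mathbf{K}^\blacktriangle_\mathbf{FDE})$ (i.e., there is a closed tree whose root is $\{w_0:\phi;\mathfrak{t},\ w_0:\chi;\overline{\mathfrak{t}}\}$), then $\phi\vdash\chi$ is valid.
   Context: Semantics. Formulas of $\mathcal{L}_\blacktriangle$: $\phi::=p\mid\neg\phi\mid\phi\wedge\phi\mid\phi\vee\phi\mid\blacktriangle\phi$, $p$ in a countable set $\mathsf{Var}$. A frame is $\langle W,R\rangle$, $W\neq\varnothing$, $R\subseteq W^2$; a model is $\langle W,R,v^+,v^-\rangle$ with independent $v^+,v^-:\mathsf{Var}\to 2^W$. $w\vDash^+p$ iff $w\in v^+(p)$; $w\vDash^-p$ iff $w\in v^-(p)$; $\neg$ swaps $\vDash^+$ and $\vDash^-$; $\wedge$: true iff both true, false iff some false; $\vee$: true iff some true, false iff both false. $w_0\vDash^+\blacktriangle\phi$ iff for all $R$-successors $w_1,w_2$ of $w_0$, ($w_1\vDash^+\phi\Rightarrow w_2\vDash^+\phi$) and ($w_1\vDash^-\phi\Rightarrow w_2\vDash^-\phi$), and every $R$-successor $w_1$ has $w_1\vDash^+\phi$ or $w_1\vDash^-\phi$. $w_0\vDash^-\blacktriangle\phi$ iff there are successors $w_1,w_2$ of $w_0$ with ($w_1\vDash^+\phi$, $w_2\nvDash^+\phi$) or ($w_1\vDash^-\phi$, $w_2\nvDash^-\phi$) or ($w_1\vDash^+\phi$, $w_2\vDash^-\phi$).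 $\phi\vdash\chi$ is valid iff in every model at every state, $\vDash^+\phi$ implies $\vDash^+\chi$. Calculus. Fix a countable set of state-labels and value-labels $\{\mathfrak{t},\mathfrak{f},\overline{\mathfrak{t}},\overline{\mathfrak{f}}\}$ (read: true, false, not-true, not-false). A labelled formula is $w:\phi;\mathfrak{v}$. Conventions: $\overline{\overline{\mathfrak{t}}}=\mathfrak{t}$, $\overline{\overline{\mathfrak{f}}}=\mathfrak{f}$; $\mathfrak{t}^\neg=\mathfrak{f}$, $\mathfrak{f}^\neg=\mathfrak{t}$, $\overline{\mathfrak{t}}^\neg=\overline{\mathfrak{f}}$, $\overline{\mathfrak{f}}^\neg=\overline{\mathfrak{t}}$; $w:\phi;\mathfrak{v}_1;\mathfrak{v}_2$ abbreviates the two labelled formulas $w:\phi;\mathfrak{v}_1$ and $w:\phi;\mathfrak{v}_2$. A proof is a downward-branching tree whose nodes are sets of labelled formulas and relational atoms $w\mathsf{R}w'$; a branch may be extended by the rules below (premises above $\Rightarrow$, conclusions after; $\{i,j\}=\{1,2\}$; $w_k,w_{k_1},w_{k_2}$ fresh on the branch): $\neg$: $w:\neg\phi;\mathfrak{t}\Rightarrow w:\phi;\mathfrak{f}$; $w:\neg\phi;\mathfrak{f}\Rightarrow w:\phi;\mathfrak{t}$; $w:\neg\phi;\overline{\mathfrak{t}}\Rightarrow w:\phi;\overline{\mathfrak{f}}$; $w:\neg\phi;\overline{\mathfrak{f}}\Rightarrow w:\phi;\overline{\mathfrak{t}}$. $\wedge$: $w:\phi_1\wedge\phi_2;\mathfrak{t}\Rightarrow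 w:\phi_1;\mathfrak{t}$ and $w:\phi_2;\mathfrak{t}$; $w:\phi_1\wedge\phi_2;\mathfrak{f}$, $w:\phi_i;\overline{\mathfrak{f}}\Rightarrow w:\phi_j;\mathfrak{f}$; $w:\phi_1\wedge\phi_2;\overline{\mathfrak{t}}$, $w:\phi_i;\mathfrak{t}\Rightarrow w:\phi_j;\overline{\mathfrak{t}}$; $w:\phi_1\wedge\phi_2;\overline{\mathfrak{f}}\Rightarrow w:\phi_1;\overline{\mathfrak{f}}$ and $w:\phi_2;\overline{\mathfrak{f}}$. $\vee$: $w:\phi_1\vee\phi_2;\mathfrak{t}$, $w:\phi_i;\overline{\mathfrak{t}}\Rightarrow w:\phi_j;\mathfrak{t}$; $w:\phi_1\vee\phi_2;\mathfrak{f}\Rightarrow w:\phi_1;\mathfrak{f}$ and $w:\phi_2;\mathfrak{f}$; $w:\phi_1\vee\phi_2;\overline{\mathfrak{t}}\Rightarrow w:\phi_1;\overline{\mathfrak{t}}$ and $w:\phi_2;\overline{\mathfrak{t}}$; $w:\phi_1\vee\phi_2;\overline{\mathfrak{f}}$, $w:\phi_i;\mathfrak{f}\Rightarrow w:\phi_j;\overline{\mathfrak{f}}$. Cut: with no premises, split the branch into $w:\phi;\mathfrak{v}\mid w:\phi;\overline{\mathfrak{v}}$, provided $\phi$ is a subformula of a formula on the branch and $w$ occurs on the branch. $\blacktriangle_T$: $w_i:\blacktriangle\phi;\mathfrak{t};\overline{\mathfrak{f}}$, $w_i\mathsf{R}w_j$, $w_j:\phi;\mathfrak{v}\Rightarrow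 w_j:\phi;\overline{\mathfrak{v}}^\neg$. $\blacktriangle'_T$: $w_i:\blacktriangle\phi;\mathfrak{t};\overline{\mathfrak{f}}$, $w_i\mathsf{R}w_{j_1}$, $w_i\mathsf{R}w_{j_2}$, $w_{j_1}:\phi;\mathfrak{v};\overline{\mathfrak{v}}^\neg\Rightarrow w_{j_2}:\phi;\mathfrak{v};\overline{\mathfrak{v}}^\neg$. $\blacktriangle_F$: $w_i:\blacktriangle\phi;\mathfrak{f};\overline{\mathfrak{t}}\Rightarrow$ add $w_i\mathsf{R}w_{k_1}$, $w_i\mathsf{R}w_{k_2}$, then split into $\{w_{k_1}:\phi;\mathfrak{t},\ w_{k_2}:\phi;\overline{\mathfrak{t}}\}\mid\{w_{k_1}:\phi;\mathfrak{f},\ w_{k_2}:\phi;\overline{\mathfrak{f}}\}$. $\blacktriangle_B$: $w_i:\blacktriangle\phi;\mathfrak{t};\mathfrak{f}$, $w_i\mathsf{R}w_j\Rightarrow w_j:\phi;\mathfrak{t};\mathfrak{f}$. $\blacktriangle^+_B$: $w_i:\blacktriangle\phi;\mathfrak{t};\mathfrak{f}\Rightarrow w_i\mathsf{R}w_k$, $w_k:\phi;\mathfrak{t};\mathfrak{f}$. $\blacktriangle_N$: $w_i:\blacktriangle\phi;\overline{\mathfrak{t}};\overline{\mathfrak{f}}$, $w_i\mathsf{R}w_j\Rightarrow w_j:\phi;\overline{\mathfrak{t}};\overline{\mathfrak{f}}$. $\blacktriangle^+_N$: $w_i:\blacktriangle\phi;\overline{\mathfrak{t}};\overline{\mathfrak{f}}\Rightarrow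 w_i\mathsf{R}w_k$, $w_k:\phi;\overline{\mathfrak{t}};\overline{\mathfrak{f}}$. A branch is closed iff it contains $w:\phi;\mathfrak{v}$ and $w:\phi;\overline{\mathfrak{v}}$ for some $w,\phi,\mathfrak{v}$; a tree is closed iff all its branches are closed. $\phi\vdash\chi$ is proved iff there is a closed tree with root $\{w_0:\phi;\mathfrak{t},\ w_0:\chi;\overline{\mathfrak{t}}\}$. -}

module Defs where

open import Data.Nat using (ℕ)
open import Data.Product using (Σ; _×_)
open import Data.Sum using (_⊎_)
open import Data.List using (List; _∷_; [])
open import Data.List.Membership.Propositional using (_∈_)
open import Data.List.Relation.Unary.Any using (Any)
open import Relation.Nullary using (¬_)
open import Relation.Binary.PropositionalEquality using (_≡_; _≢_)

data Form : Set where
  var : ℕ → Form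
  neg : Form → Form
  _∧'_ : Form → Form → Form
  _∨'_ : Form → Form → Form
  tri : Form → Form

data _⊑_ : Form → Form → Set where
  ⊑-refl : ∀ {φ} → φ ⊑ φ
  ⊑-neg  : ∀ {φ ψ} → φ ⊑ ψ → φ ⊑ neg ψ
  ⊑-∧ˡ   : ∀ {φ ψ₁ ψ₂} → φ ⊑ ψ₁ → φ ⊑ (ψ₁ ∧' ψ₂)
  ⊑-∧ʳ   : ∀ {φ ψ₁ ψ₂} → φ ⊑ ψ₂ → φ ⊑ (ψ₁ ∧' ψ₂)
  ⊑-∨ˡ   : ∀ {φ ψ₁ ψ₂} → φ ⊑ ψ₁ → φ ⊑ (ψ₁ ∨' ψ₂)
  ⊑-∨ʳ   : ∀ {φ ψ₁ ψ₂} → φ ⊑ ψ₂ → φ ⊑ (ψ₁ ∨' ψ₂)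
  ⊑-tri  : ∀ {φ ψ} → φ ⊑ ψ → φ ⊑ tri ψ

record Model : Set₁ where
  field
    W  : Set
    R  : W → W → Set
    v⁺ : ℕ → W → Set
    v⁻ : ℕ → W → Set

module _ (M : Model) where
  open Model M

  -- T φ w :  w ⊨⁺ φ ;   F φ w :  w ⊨⁻ φ
  T F : Form → W → Set
  T (var p) w = v⁺ p w
  T (neg φ) w = F φ w
  T (φ ∧' ψ) w = T φ w × T ψ w
  T (φ ∨' ψ) w = T φ w ⊎ T ψ w
  T (tri φ) w =
    (∀ w₁ w₂ → R w w₁ → R w w₂ → (T φ w₁ → T φ w₂) × (F φ w₁ → F φ w₂))
    × (∀ w₁ → R w w₁ → T φ w₁ ⊎ F φ w₁)
  F (var p) w = v⁻ p w
  F (neg φ) w = T φ w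
  F (φ ∧' ψ) w = F φ w ⊎ F ψ w
  F (φ ∨' ψ) w = F φ w × F ψ w
  F (tri φ) w =
    Σ W λ w₁ → Σ W λ w₂ → R w w₁ × R w w₂ ×
      ((T φ w₁ × ¬ T φ w₂) ⊎ (F φ w₁ × ¬ F φ w₂) ⊎ (T φ w₁ × F φ w₂))

Valid : Form → Form → Set₁
Valid φ χ = (M : Model) (w : Model.W M) → T M φ w → T M χ w

-- value labels: t, f, t̄ (not-true), f̄ (not-false)
data Val : Set where
  𝔱 𝔣 n𝔱 n𝔣 : Val

bar : Val → Val
bar 𝔱 = n𝔱
bar 𝔣 = n𝔣
bar n𝔱 = 𝔱
bar n𝔣 = 𝔣

negV : Val → Val
negV 𝔱 = 𝔣
negV 𝔣 = 𝔱
negV n𝔱 = n𝔣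
negV n𝔣 = n𝔱

data Item : Set where
  lab : ℕ → Form → Val → Item
  rel : ℕ → ℕ → Item

Branch : Set
Branch = List Item

data Mentions (w : ℕ) : Item → Set where
  m-lab  : ∀ {φ v} → Mentions w (lab w φ v)
  m-relˡ : ∀ {u} → Mentions w (rel w u)
  m-relʳ : ∀ {u} → Mentions w (rel u w)

Occurs : ℕ → Branch → Set
Occurs w B = Any (Mentions w) B

Fresh : ℕ → Branch → Set
Fresh w B = ¬ Occurs w B

-- Closed B : there is a closed (finite) tree extending the branch B
data Closed : Branch → Set where
  close : ∀ {B w φ v} → lab w φ v ∈ B → lab w φ (bar v) ∈ B → Closed B
  -- ¬ (all four rules at once: conclusion value is 𝔳^¬)
  r¬ : ∀ {B w φ v} → lab w (neg φ) v ∈ B → Closed (lab w φ (negV v) ∷ B) → Closed B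
  r∧𝔱 : ∀ {B w φ₁ φ₂} → lab w (φ₁ ∧' φ₂) 𝔱 ∈ B →
        Closed (lab w φ₁ 𝔱 ∷ lab w φ₂ 𝔱 ∷ B) → Closed B
  r∧𝔣₁ : ∀ {B w φ₁ φ₂} → lab w (φ₁ ∧' φ₂) 𝔣 ∈ B → lab w φ₁ n𝔣 ∈ B →
        Closed (lab w φ₂ 𝔣 ∷ B) → Closed B
  r∧𝔣₂ : ∀ {B w φ₁ φ₂} → lab w (φ₁ ∧' φ₂) 𝔣 ∈ B → lab w φ₂ n𝔣 ∈ B →
        Closed (lab w φ₁ 𝔣 ∷ B) → Closed B
  r∧n𝔱₁ : ∀ {B w φ₁ φ₂} → lab w (φ₁ ∧' φ₂) n𝔱 ∈ B → lab w φ₁ 𝔱 ∈ B →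
        Closed (lab w φ₂ n𝔱 ∷ B) → Closed B
  r∧n𝔱₂ : ∀ {B w φ₁ φ₂} → lab w (φ₁ ∧' φ₂) n𝔱 ∈ B → lab w φ₂ 𝔱 ∈ B →
        Closed (lab w φ₁ n𝔱 ∷ B) → Closed B
  r∧n𝔣 : ∀ {B w φ₁ φ₂} → lab w (φ₁ ∧' φ₂) n𝔣 ∈ B →
        Closed (lab w φ₁ n𝔣 ∷ lab w φ₂ n𝔣 ∷ B) → Closed B
  r∨𝔱₁ : ∀ {B w φ₁ φ₂} → lab w (φ₁ ∨' φ₂) 𝔱 ∈ B → lab w φ₁ n𝔱 ∈ B →
        Closed (lab w φ₂ 𝔱 ∷ B) → Closed B
  r∨𝔱₂ : ∀ {B w φ₁ φ₂} → lab w (φ₁ ∨' φ₂) 𝔱 ∈ B → lab w φ₂ n𝔱 ∈ B →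
        Closed (lab w φ₁ 𝔱 ∷ B) → Closed B
  r∨𝔣 : ∀ {B w φ₁ φ₂} → lab w (φ₁ ∨' φ₂) 𝔣 ∈ B →
        Closed (lab w φ₁ 𝔣 ∷ lab w φ₂ 𝔣 ∷ B) → Closed B
  r∨n𝔱 : ∀ {B w φ₁ φ₂} → lab w (φ₁ ∨' φ₂) n𝔱 ∈ B →
        Closed (lab w φ₁ n𝔱 ∷ lab w φ₂ n𝔱 ∷ B) → Closed B
  r∨n𝔣₁ : ∀ {B w φ₁ φ₂} → lab w (φ₁ ∨' φ₂) n𝔣 ∈ B → lab w φ₁ 𝔣 ∈ B →
        Closed (lab w φ₂ n𝔣 ∷ B) → Closed B
  r∨n𝔣₂ : ∀ {B w φ₁ φ₂} → lab w (φ₁ ∨' φ₂) n𝔣 ∈ B → lab w φ₂ 𝔣 ∈ B →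
        Closed (lab w φ₁ n𝔣 ∷ B) → Closed B
  cut : ∀ {B w φ v u ψ v'} → lab u ψ v' ∈ B → φ ⊑ ψ → Occurs w B →
        Closed (lab w φ v ∷ B) → Closed (lab w φ (bar v) ∷ B) → Closed B
  r▲T : ∀ {B i j φ v} → lab i (tri φ) 𝔱 ∈ B → lab i (tri φ) n𝔣 ∈ B →
        rel i j ∈ B → lab j φ v ∈ B →
        Closed (lab j φ (negV (bar v)) ∷ B) → Closed B
  r▲'T : ∀ {B i j₁ j₂ φ v} → lab i (tri φ) 𝔱 ∈ B → lab i (tri φ) n𝔣 ∈ B →
        rel i j₁ ∈ B → rel i j₂ ∈ B →
        lab j₁ φ v ∈ B → lab j₁ φ (negV (bar v)) ∈ B →
        Closed (lab j₂ φ v ∷ lab j₂ φ (negV (bar v)) ∷ B) → Closed B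
  r▲F : ∀ {B i k₁ k₂ φ} → lab i (tri φ) 𝔣 ∈ B → lab i (tri φ) n𝔱 ∈ B →
        k₁ ≢ k₂ → Fresh k₁ B → Fresh k₂ B →
        Closed (lab k₁ φ 𝔱 ∷ lab k₂ φ n𝔱 ∷ rel i k₁ ∷ rel i k₂ ∷ B) →
        Closed (lab k₁ φ 𝔣 ∷ lab k₂ φ n𝔣 ∷ rel i k₁ ∷ rel i k₂ ∷ B) →
        Closed B
  r▲B : ∀ {B i j φ} → lab i (tri φ) 𝔱 ∈ B → lab i (tri φ) 𝔣 ∈ B → rel i j ∈ B →
        Closed (lab j φ 𝔱 ∷ lab j φ 𝔣 ∷ B) → Closed B
  r▲⁺B : ∀ {B i k φ} → lab i (tri φ) 𝔱 ∈ B → lab i (tri φ) 𝔣 ∈ B → Fresh k B →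
        Closed (rel i k ∷ lab k φ 𝔱 ∷ lab k φ 𝔣 ∷ B) → Closed B
  r▲N : ∀ {B i j φ} → lab i (tri φ) n𝔱 ∈ B → lab i (tri φ) n𝔣 ∈ B → rel i j ∈ B →
        Closed (lab j φ n𝔱 ∷ lab j φ n𝔣 ∷ B) → Closed B
  r▲⁺N : ∀ {B i k φ} → lab i (tri φ) n𝔱 ∈ B → lab i (tri φ) n𝔣 ∈ B → Fresh k B →
        Closed (rel i k ∷ lab k φ n𝔱 ∷ lab k φ n𝔣 ∷ B) → Closed B

Proved : Form → Form → Set
Proved φ χ = Closed (lab 0 φ 𝔱 ∷ lab 0 χ n𝔱 ∷ [])

{-# OPTIONS --safe #-}
module Submission where

-- Interpret state labels by worlds of a countermodel, reading 𝔱/𝔣 as ⊨⁺/⊨⁻ and t̄/f̄ as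
-- their meta-level negations. Every rule turns a satisfied branch into a satisfied branch
-- among its conclusions (freshness lets new labels be sent to the worlds witnessing ▲φ),
-- and a closed branch cannot be satisfied. Classical logic enters through cut and the
-- ▲-rules: that ▲φ is not false yields that all successors agree on φ only by double
-- negation elimination.

open import Defs
open import Level using (0ℓ)
open import Axiom.ExcludedMiddle using (ExcludedMiddle)
open import Function using (_∘_; id)
open import Data.Nat using (ℕ; _≟_)
open import Data.Product using (Σ; _×_; _,_; proj₁; proj₂)
open import Data.Sum using (_⊎_; inj₁; inj₂; [_,_]; swap)
import Data.Sum as Sum
open import Data.Empty using (⊥-elim)
open import Data.List using (_∷_)
open import Data.List.Membership.Propositional using (lose)
open import Data.List.Relation.Unary.Any using (here; there)
open import Data.List.Relation.Unary.All using (All; _∷_; []; lookup)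
open import Relation.Nullary using (¬_; yes; no)
open import Relation.Nullary.Decidable using (toSum; decidable-stable)
open import Relation.Binary.PropositionalEquality using (_≡_; _≢_; refl; sym; trans; subst; subst₂)

module Soundness (lem : ExcludedMiddle 0ℓ) (M : Model) where
  open Model M

  _⊨⁺_ _⊨⁻_ : W → Form → Set
  a ⊨⁺ φ = T M φ a
  a ⊨⁻ φ = F M φ a

  _⊨[_]_ : W → Val → Form → Set
  a ⊨[ 𝔱 ] φ = a ⊨⁺ φ
  a ⊨[ 𝔣 ] φ = a ⊨⁻ φ
  a ⊨[ n𝔱 ] φ = ¬ a ⊨⁺ φ
  a ⊨[ n𝔣 ] φ = ¬ a ⊨⁻ φ

  holds-bar-incompatible : ∀ v {a φ} → a ⊨[ v ] φ → ¬ a ⊨[ bar v ] φ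
  holds-bar-incompatible 𝔱 s s̄ = s̄ s
  holds-bar-incompatible 𝔣 s s̄ = s̄ s
  holds-bar-incompatible n𝔱 s s̄ = s s̄
  holds-bar-incompatible n𝔣 s s̄ = s s̄

  holds-or-holds-bar : ∀ v a φ → a ⊨[ v ] φ ⊎ a ⊨[ bar v ] φ
  holds-or-holds-bar 𝔱 a φ = toSum lem
  holds-or-holds-bar 𝔣 a φ = toSum lem
  holds-or-holds-bar n𝔱 a φ = swap (toSum lem)
  holds-or-holds-bar n𝔣 a φ = swap (toSum lem)

  holds-neg : ∀ v {a φ} → a ⊨[ v ] neg φ → a ⊨[ negV v ] φ
  holds-neg 𝔱 s = s
  holds-neg 𝔣 s = s
  holds-neg n𝔱 s = s
  holds-neg n𝔣 s = s

  Glut Gap : Form → W → Set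
  Glut φ a = a ⊨⁺ φ × a ⊨⁻ φ
  Gap φ a = ¬ a ⊨⁺ φ × ¬ a ⊨⁻ φ

  -- x ⊨⁺ tri φ unfolds to Stable φ x × Determined φ x.
  Stable Determined Break : Form → W → Set
  Stable φ x = ∀ a b → R x a → R x b → (a ⊨⁺ φ → b ⊨⁺ φ) × (a ⊨⁻ φ → b ⊨⁻ φ)
  Determined φ x = ∀ a → R x a → a ⊨⁺ φ ⊎ a ⊨⁻ φ
  Break φ x = Σ W λ a → Σ W λ b → R x a × R x b × ((a ⊨⁺ φ × ¬ b ⊨⁺ φ) ⊎ (a ⊨⁻ φ × ¬ b ⊨⁻ φ))

  stable-preserves : ∀ φ {x a b} → Stable φ x → R x a → R x b → ∀ v → a ⊨[ v ] φ → b ⊨[ v ] φ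
  stable-preserves _ st ra rb 𝔱 = proj₁ (st _ _ ra rb)
  stable-preserves _ st ra rb 𝔣 = proj₂ (st _ _ ra rb)
  stable-preserves _ st ra rb n𝔱 ¬ta tb = ¬ta (proj₁ (st _ _ rb ra) tb)
  stable-preserves _ st ra rb n𝔣 ¬fa fb = ¬fa (proj₂ (st _ _ rb ra) fb)

  ¬break⇒stable : ∀ φ {x} → ¬ Break φ x → Stable φ x
  ¬break⇒stable φ ¬break a b ra rb = preserve⁺ , preserve⁻
    where
    preserve⁺ : a ⊨⁺ φ → b ⊨⁺ φ
    preserve⁺ ta = decidable-stable lem λ ¬tb → ¬break (a , b , ra , rb , inj₁ (ta , ¬tb))
    preserve⁻ : a ⊨⁻ φ → b ⊨⁻ φ
    preserve⁻ fa = decidable-stable lem λ ¬fb → ¬break (a , b , ra , rb , inj₂ (fa , ¬fb))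

  ¬false-▲⇒stable : ∀ φ {x} → ¬ x ⊨⁻ tri φ → Stable φ x
  ¬false-▲⇒stable φ ¬f = ¬break⇒stable φ λ
    { (a , b , ra , rb , inj₁ c) → ¬f (a , b , ra , rb , inj₁ c)
    ; (a , b , ra , rb , inj₂ c) → ¬f (a , b , ra , rb , inj₂ (inj₁ c)) }

  stable+determined-successor⇒true-▲ : ∀ φ {x a} → Stable φ x → R x a → a ⊨⁺ φ ⊎ a ⊨⁻ φ →
                                       x ⊨⁺ tri φ
  stable+determined-successor⇒true-▲ _ st ra d =
    st , λ u ru → Sum.map (proj₁ (st _ u ra ru)) (proj₂ (st _ u ra ru)) d

  true-nonfalse-▲⇒bivalent-successors : ∀ φ {x a} → x ⊨⁺ tri φ → ¬ x ⊨⁻ tri φ → R x a →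
                                         ∀ v → a ⊨[ v ] φ → a ⊨[ negV (bar v) ] φ
  true-nonfalse-▲⇒bivalent-successors _ _ ¬f ra 𝔱 ta fa = ¬f (_ , _ , ra , ra , inj₂ (inj₂ (ta , fa)))
  true-nonfalse-▲⇒bivalent-successors _ _ ¬f ra 𝔣 fa ta = ¬f (_ , _ , ra , ra , inj₂ (inj₂ (ta , fa)))
  true-nonfalse-▲⇒bivalent-successors _ (_ , det) _ ra n𝔱 ¬ta = [ ⊥-elim ∘ ¬ta , id ] (det _ ra)
  true-nonfalse-▲⇒bivalent-successors _ (_ , det) _ ra n𝔣 ¬fa = [ id , ⊥-elim ∘ ¬fa ] (det _ ra)

  -- Without a break the successors are stable, and the first witness of falsity is
  -- determined, so ▲φ would be true.
  false-nontrue-▲⇒break : ∀ φ {x} → x ⊨⁻ tri φ → ¬ x ⊨⁺ tri φ → Break φ x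
  false-nontrue-▲⇒break φ (a , b , ra , _ , witness) ¬t = decidable-stable lem λ ¬break →
    ¬t (stable+determined-successor⇒true-▲ φ (¬break⇒stable φ ¬break) ra (a-determined witness))
    where
    a-determined : (a ⊨⁺ φ × ¬ b ⊨⁺ φ) ⊎ (a ⊨⁻ φ × ¬ b ⊨⁻ φ) ⊎ (a ⊨⁺ φ × b ⊨⁻ φ) →
                   a ⊨⁺ φ ⊎ a ⊨⁻ φ
    a-determined = [ inj₁ ∘ proj₁ , [ inj₂ ∘ proj₁ , inj₁ ∘ proj₁ ] ]

  glut-▲⇒successors-glut : ∀ φ {x b} → Glut (tri φ) x → R x b → Glut φ b
  glut-▲⇒successors-glut φ ((st , _) , (a , a′ , ra , ra′ , inj₁ (ta , ¬ta′))) _ =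
    ⊥-elim (¬ta′ (stable-preserves φ st ra ra′ 𝔱 ta))
  glut-▲⇒successors-glut φ ((st , _) , (a , a′ , ra , ra′ , inj₂ (inj₁ (fa , ¬fa′)))) _ =
    ⊥-elim (¬fa′ (stable-preserves φ st ra ra′ 𝔣 fa))
  glut-▲⇒successors-glut φ ((st , _) , (a , a′ , ra , ra′ , inj₂ (inj₂ (ta , fa′)))) rb =
    stable-preserves φ st ra rb 𝔱 ta , stable-preserves φ st ra′ rb 𝔣 fa′

  glut-▲⇒glut-successor : ∀ φ {x} → Glut (tri φ) x → Σ W λ a → R x a × Glut φ a
  glut-▲⇒glut-successor φ g@(_ , (a , _ , ra , _)) = a , ra , glut-▲⇒successors-glut φ g ra

  gap-▲⇒successors-gap : ∀ φ {x b} → Gap (tri φ) x → R x b → Gap φ b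
  gap-▲⇒successors-gap φ (¬t , ¬f) rb =
    (λ tb → ¬t (stable+determined-successor⇒true-▲ φ st rb (inj₁ tb))) ,
    (λ fb → ¬t (stable+determined-successor⇒true-▲ φ st rb (inj₂ fb)))
    where st = ¬false-▲⇒stable φ ¬f

  gap-▲⇒gap-successor : ∀ φ {x} → Gap (tri φ) x → Σ W λ a → R x a × Gap φ a
  gap-▲⇒gap-successor φ {x} (¬t , ¬f) = decidable-stable lem λ ¬gap →
    ¬t (¬false-▲⇒stable φ ¬f , determined ¬gap)
    where
    determined : ¬ (Σ W λ a → R x a × Gap φ a) → Determined φ x
    determined ¬gap a ra with toSum (lem {a ⊨⁺ φ}) | toSum (lem {a ⊨⁻ φ})
    ... | inj₁ ta | _ = inj₁ ta
    ... | inj₂ _ | inj₁ fa = inj₂ fa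
    ... | inj₂ ¬ta | inj₂ ¬fa = ⊥-elim (¬gap (a , ra , ¬ta , ¬fa))

  Assignment : Set
  Assignment = ℕ → W

  infix 4 _⊨ᵢ_ _⊨_
  infixl 9 _[_↦_]

  _⊨ᵢ_ : Assignment → Item → Set
  ρ ⊨ᵢ lab w φ v = ρ w ⊨[ v ] φ
  ρ ⊨ᵢ rel i j = R (ρ i) (ρ j)

  _⊨_ : Assignment → Branch → Set
  ρ ⊨ B = All (ρ ⊨ᵢ_) B

  agree⇒sat : ∀ {ρ ρ′} x → (∀ {n} → Mentions n x → ρ′ n ≡ ρ n) → ρ ⊨ᵢ x → ρ′ ⊨ᵢ x
  agree⇒sat (lab w φ v) agree = subst (_⊨[ v ] φ) (sym (agree m-lab))
  agree⇒sat (rel i j) agree = subst₂ R (sym (agree m-relˡ)) (sym (agree m-relʳ))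

  _[_↦_] : Assignment → ℕ → W → Assignment
  (ρ [ k ↦ a ]) n with n ≟ k
  ... | yes _ = a
  ... | no _ = ρ n

  update-≡ : ∀ ρ k a → (ρ [ k ↦ a ]) k ≡ a
  update-≡ ρ k a with k ≟ k
  ... | yes _ = refl
  ... | no k≢k = ⊥-elim (k≢k refl)

  update-≢ : ∀ ρ k a n → n ≢ k → (ρ [ k ↦ a ]) n ≡ ρ n
  update-≢ ρ k a n n≢k with n ≟ k
  ... | yes n≡k = ⊥-elim (n≢k n≡k)
  ... | no _ = refl

  update-unmentioned : ∀ {ρ k a} x → ¬ Mentions k x → ρ ⊨ᵢ x → ρ [ k ↦ a ] ⊨ᵢ x
  update-unmentioned {ρ} {k} {a} x ¬m =
    agree⇒sat {ρ′ = ρ [ k ↦ a ]} x λ {n} m → update-≢ ρ k a n λ { refl → ¬m m }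

  update-fresh : ∀ {ρ k a B} → Fresh k B → ρ ⊨ B → ρ [ k ↦ a ] ⊨ B
  update-fresh fr [] = []
  update-fresh fr (s ∷ S) = update-unmentioned _ (fr ∘ here) s ∷ update-fresh (fr ∘ there) S

  occurs⇒≢-fresh : ∀ {i k B} → Occurs i B → Fresh k B → i ≢ k
  occurs⇒≢-fresh o fr refl = fr o

  extend-by-fresh-successor : ∀ {ρ i k a φ v₁ v₂ B} → Occurs i B → Fresh k B → ρ ⊨ B →
                              R (ρ i) a → a ⊨[ v₁ ] φ → a ⊨[ v₂ ] φ →
                              ρ [ k ↦ a ] ⊨ rel i k ∷ lab k φ v₁ ∷ lab k φ v₂ ∷ B
  extend-by-fresh-successor {ρ} {i} {k} {a} {φ} {v₁} {v₂} oᵢ fr S ra s₁ s₂ =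
    subst₂ R (sym ρ′i) (sym ρ′k) ra ∷
    subst (_⊨[ v₁ ] φ) (sym ρ′k) s₁ ∷ subst (_⊨[ v₂ ] φ) (sym ρ′k) s₂ ∷
    update-fresh fr S
    where
    ρ′k : (ρ [ k ↦ a ]) k ≡ a
    ρ′k = update-≡ ρ k a
    ρ′i : (ρ [ k ↦ a ]) i ≡ ρ i
    ρ′i = update-≢ ρ k a i (occurs⇒≢-fresh oᵢ fr)

  extend-by-fresh-successors : ∀ {ρ i k₁ k₂ a b φ v B} →
                               Occurs i B → k₁ ≢ k₂ → Fresh k₁ B → Fresh k₂ B → ρ ⊨ B →
                               R (ρ i) a → R (ρ i) b → a ⊨[ v ] φ → b ⊨[ bar v ] φ →
                               ρ [ k₁ ↦ a ] [ k₂ ↦ b ] ⊨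
                                 lab k₁ φ v ∷ lab k₂ φ (bar v) ∷ rel i k₁ ∷ rel i k₂ ∷ B
  extend-by-fresh-successors {ρ} {i} {k₁} {k₂} {a} {b} {φ} {v} oᵢ k₁≢k₂ fr₁ fr₂ S ra rb sa sb =
    subst (_⊨[ v ] φ) (sym ρ′k₁) sa ∷ subst (_⊨[ bar v ] φ) (sym ρ′k₂) sb ∷
    subst₂ R (sym ρ′i) (sym ρ′k₁) ra ∷ subst₂ R (sym ρ′i) (sym ρ′k₂) rb ∷
    update-fresh fr₂ (update-fresh fr₁ S)
    where
    ρ′k₁ : (ρ [ k₁ ↦ a ] [ k₂ ↦ b ]) k₁ ≡ a
    ρ′k₁ = trans (update-≢ _ k₂ b k₁ k₁≢k₂) (update-≡ ρ k₁ a)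
    ρ′k₂ : (ρ [ k₁ ↦ a ] [ k₂ ↦ b ]) k₂ ≡ b
    ρ′k₂ = update-≡ _ k₂ b
    ρ′i : (ρ [ k₁ ↦ a ] [ k₂ ↦ b ]) i ≡ ρ i
    ρ′i = trans (update-≢ _ k₂ b i (occurs⇒≢-fresh oᵢ fr₂))
                (update-≢ ρ k₁ a i (occurs⇒≢-fresh oᵢ fr₁))

  closed⇒unsatisfiable : ∀ {B} → Closed B → ∀ ρ → ¬ ρ ⊨ B
  closed⇒unsatisfiable (close {v = v} p q) ρ S = holds-bar-incompatible v (lookup S p) (lookup S q)
  closed⇒unsatisfiable (r¬ {v = v} p c) ρ S = closed⇒unsatisfiable c ρ (holds-neg v (lookup S p) ∷ S)
  closed⇒unsatisfiable (r∧𝔱 p c) ρ S =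
    closed⇒unsatisfiable c ρ (proj₁ (lookup S p) ∷ proj₂ (lookup S p) ∷ S)
  closed⇒unsatisfiable (r∧𝔣₁ p q c) ρ S =
    [ lookup S q , (λ f₂ → closed⇒unsatisfiable c ρ (f₂ ∷ S)) ] (lookup S p)
  closed⇒unsatisfiable (r∧𝔣₂ p q c) ρ S =
    [ (λ f₁ → closed⇒unsatisfiable c ρ (f₁ ∷ S)) , lookup S q ] (lookup S p)
  closed⇒unsatisfiable (r∧n𝔱₁ p q c) ρ S =
    closed⇒unsatisfiable c ρ ((λ t₂ → lookup S p (lookup S q , t₂)) ∷ S)
  closed⇒unsatisfiable (r∧n𝔱₂ p q c) ρ S =
    closed⇒unsatisfiable c ρ ((λ t₁ → lookup S p (t₁ , lookup S q)) ∷ S)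
  closed⇒unsatisfiable (r∧n𝔣 p c) ρ S =
    closed⇒unsatisfiable c ρ (lookup S p ∘ inj₁ ∷ lookup S p ∘ inj₂ ∷ S)
  closed⇒unsatisfiable (r∨𝔱₁ p q c) ρ S =
    [ lookup S q , (λ t₂ → closed⇒unsatisfiable c ρ (t₂ ∷ S)) ] (lookup S p)
  closed⇒unsatisfiable (r∨𝔱₂ p q c) ρ S =
    [ (λ t₁ → closed⇒unsatisfiable c ρ (t₁ ∷ S)) , lookup S q ] (lookup S p)
  closed⇒unsatisfiable (r∨𝔣 p c) ρ S =
    closed⇒unsatisfiable c ρ (proj₁ (lookup S p) ∷ proj₂ (lookup S p) ∷ S)
  closed⇒unsatisfiable (r∨n𝔱 p c) ρ S =
    closed⇒unsatisfiable c ρ (lookup S p ∘ inj₁ ∷ lookup S p ∘ inj₂ ∷ S)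
  closed⇒unsatisfiable (r∨n𝔣₁ p q c) ρ S =
    closed⇒unsatisfiable c ρ ((λ f₂ → lookup S p (lookup S q , f₂)) ∷ S)
  closed⇒unsatisfiable (r∨n𝔣₂ p q c) ρ S =
    closed⇒unsatisfiable c ρ ((λ f₁ → lookup S p (f₁ , lookup S q)) ∷ S)
  closed⇒unsatisfiable (cut {w = w} {φ} {v} _ _ _ c c̄) ρ S =
    [ (λ s → closed⇒unsatisfiable c ρ (s ∷ S)) , (λ s̄ → closed⇒unsatisfiable c̄ ρ (s̄ ∷ S)) ]
      (holds-or-holds-bar v (ρ w) φ)
  closed⇒unsatisfiable (r▲T {φ = φ} {v = v} t f̄ r s c) ρ S =
    closed⇒unsatisfiable c ρ
      (true-nonfalse-▲⇒bivalent-successors φ (lookup S t) (lookup S f̄) (lookup S r) v (lookup S s) ∷ S)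
  closed⇒unsatisfiable (r▲'T {φ = φ} {v} t _ r₁ r₂ s s′ c) ρ S =
    closed⇒unsatisfiable c ρ (preserve v (lookup S s) ∷ preserve (negV (bar v)) (lookup S s′) ∷ S)
    where preserve = stable-preserves φ (proj₁ (lookup S t)) (lookup S r₁) (lookup S r₂)
  closed⇒unsatisfiable (r▲F {φ = φ} f t̄ k₁≢k₂ fr₁ fr₂ c𝔱 c𝔣) ρ S
    with false-nontrue-▲⇒break φ (lookup S f) (lookup S t̄)
  ... | a , b , ra , rb , inj₁ (ta , ¬tb) =
    closed⇒unsatisfiable c𝔱 _ (extend-by-fresh-successors (lose f m-lab) k₁≢k₂ fr₁ fr₂ S ra rb ta ¬tb)
  ... | a , b , ra , rb , inj₂ (fa , ¬fb) =
    closed⇒unsatisfiable c𝔣 _ (extend-by-fresh-successors (lose f m-lab) k₁≢k₂ fr₁ fr₂ S ra rb fa ¬fb)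
  closed⇒unsatisfiable (r▲B {φ = φ} t f r c) ρ S =
    closed⇒unsatisfiable c ρ (proj₁ glut ∷ proj₂ glut ∷ S)
    where glut = glut-▲⇒successors-glut φ (lookup S t , lookup S f) (lookup S r)
  closed⇒unsatisfiable (r▲⁺B {φ = φ} t f fresh c) ρ S
    with glut-▲⇒glut-successor φ (lookup S t , lookup S f)
  ... | a , ra , ta , fa =
    closed⇒unsatisfiable c _ (extend-by-fresh-successor (lose t m-lab) fresh S ra ta fa)
  closed⇒unsatisfiable (r▲N {φ = φ} t̄ f̄ r c) ρ S =
    closed⇒unsatisfiable c ρ (proj₁ gap ∷ proj₂ gap ∷ S)
    where gap = gap-▲⇒successors-gap φ (lookup S t̄ , lookup S f̄) (lookup S r)
  closed⇒unsatisfiable (r▲⁺N {φ = φ} t̄ f̄ fresh c) ρ S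
    with gap-▲⇒gap-successor φ (lookup S t̄ , lookup S f̄)
  ... | a , ra , ¬ta , ¬fa =
    closed⇒unsatisfiable c _ (extend-by-fresh-successor (lose t̄ m-lab) fresh S ra ¬ta ¬fa)

theorem2 : ExcludedMiddle 0ℓ → ∀ φ χ → Proved φ χ → Valid φ χ
theorem2 lem φ χ proof M w wφ =
  decidable-stable lem λ ¬wχ → closed⇒unsatisfiable proof (λ _ → w) (wφ ∷ ¬wχ ∷ [])
  where open Soundness lem M
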